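{- Let $V$ be a finite set of cardinality $v$ and let $D_1,D_2$ be block designs built on $V$ with parameters $(v,b_i,r_i,k_i,\lambda_i)$, $i=1,2$, with blocks listed as $B_1^1,\dots,B_1^{b_1}$ and $B_2^1,\dots,B_2^{b_2}$. Let $M$ be the $b_1\times b_2$ matrix with entries $M_{ij}=|B_1^i\cap B_2^j|$. Then every diagonal entry of $MM^T$ equals $$(MM^T)_{nn}=k_1(\lambda_2k_1-\lambda_2+r_2),\qquad n=1,\dots,b_1.$$
   Context: A (balanced incomplete) block design with parameters $(v,b,r,k,\lambda)$ built on a finite set $V$ with $|V|=v$ is a list (repetitions allowed) of $b$ blocks, each a $k$-element subset of $V$ with $k<v$, such that every element of $V$ lies in exactly $r$ blocks and every pair of distinct elements of $V$ lies in exactly $\lambda$ blocks; here $b,r,k,\lambda$ are positive integers, except that the paper also regards the design whose blocks are the $v$ one-element subsets of $V$ (parameters $b=v$, $r=k=1$, $\lambda=0$) as a block design. The matrix $M$ is called the mutual incidence matrix of $D_1$ and $D_2$. -}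

module Defs where

open import Data.Nat using (ℕ; zero; suc; _+_; _*_; _∸_; _<_)
open import Data.Fin using (Fin; zero; suc)
open import Data.Fin.Subset using (Subset; _∈_; ∣_∣; _∩_)
open import Data.Fin.Subset.Properties using (_∈?_)
open import Data.Product using (_×_)
open import Data.Sum using (_⊎_)
open import Relation.Binary.PropositionalEquality using (_≡_; _≢_)
open import Relation.Nullary using (Dec; yes; no)

sumFin : (n : ℕ) → (Fin n → ℕ) → ℕ
sumFin zero f = 0
sumFin (suc n) f = f zero + sumFin n (λ i → f (suc i))


indicator : {A : Set} → Dec A → ℕ
indicator (yes _) = 1
indicator (no _) = 0

repl : {v b : ℕ} → (Fin b → Subset v) → Fin v → ℕ
repl {v} {b} B x = sumFin b (λ j → indicator (x ∈? B j))

pairRepl : {v b : ℕ} → (Fin b → Subset v) → Fin v → Fin v → ℕ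
pairRepl {v} {b} B x y = sumFin b (λ j → indicator (x ∈? B j) * indicator (y ∈? B j))

-- A block design on V = Fin v with parameters (v,b,r,k,λ): a list of b blocks
-- (repetitions allowed), indexed by Fin b.
record IsBlockDesign (v b r k lam : ℕ) (B : Fin b → Subset v) : Set where
  field
    blockSize : ∀ j → ∣ B j ∣ ≡ k
    k<v       : k < v
    replication : ∀ x → repl B x ≡ r
    balance   : ∀ x y → x ≢ y → pairRepl B x y ≡ lam
    positivity : (0 < b × 0 < r × 0 < k × 0 < lam)
               ⊎ (b ≡ v × r ≡ 1 × k ≡ 1 × lam ≡ 0)

mutualIncidence : {v b₁ b₂ : ℕ} → (Fin b₁ → Subset v) → (Fin b₂ → Subset v)
                → Fin b₁ → Fin b₂ → ℕ
mutualIncidence B₁ B₂ i j = ∣ B₁ i ∩ B₂ j ∣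

MMᵀ : {b₁ b₂ : ℕ} → (Fin b₁ → Fin b₂ → ℕ) → Fin b₁ → Fin b₁ → ℕ
MMᵀ {b₁} {b₂} M n m = sumFin b₂ (λ j → M n j * M m j)

-- Writing A for the n-th block of D₁, (MMᵀ)ₙₙ = Σⱼ |A ∩ B₂ʲ|² expands to
-- Σ_{x,y ∈ A} #{j | x, y ∈ B₂ʲ}: each term counts the blocks of D₂ through x
-- and y, which is r₂ on the diagonal and λ₂ off it.
-- Hence (MMᵀ)ₙₙ = r₂ k₁ + λ₂ (k₁² − k₁).
module Submission where

open import Defs
open import Data.Nat using (ℕ; zero; suc; _+_; _*_; _∸_)
open import Data.Nat.Properties
  using (+-*-semiring; +-comm; +-identityʳ; *-assoc; *-suc; +-cancelʳ-≡; m+n∸m≡n)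
open import Data.Nat.Tactic.RingSolver using (solve-∀)
open import Data.Fin using (Fin; zero; suc; _≟_)
open import Data.Fin.Properties using (suc-injective)
open import Data.Fin.Subset using (Subset; ∣_∣; _∩_; inside; outside)
open import Data.Fin.Subset.Properties using (_∈?_; ∩⇔×; drop-there)
open import Data.Vec using ([]; _∷_; there)
open import Data.Empty using (⊥-elim)
open import Function using (_∘_)
open import Function.Bundles using (_⇔_; mk⇔; module Equivalence)
open import Relation.Nullary using (Dec; yes; no)
open import Relation.Nullary.Decidable using (_×-dec_)
open import Relation.Binary.PropositionalEquality
open ≡-Reasoning
open import Algebra.Properties.Semiring.Sum +-*-semiring
  using (sum; sum-syntax; sum-cong-≗; sum-replicate-zero;
         ∑-distrib-+; ∑-comm; *-distribˡ-sum; *-distribʳ-sum)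

indicator-⇔ : ∀ {A B : Set} → A ⇔ B → (a : Dec A) (b : Dec B) → indicator a ≡ indicator b
indicator-⇔ _   (yes _) (yes _) = refl
indicator-⇔ A⇔B (yes a) (no ¬b) = ⊥-elim (¬b (Equivalence.to A⇔B a))
indicator-⇔ A⇔B (no ¬a) (yes b) = ⊥-elim (¬a (Equivalence.from A⇔B b))
indicator-⇔ _   (no _)  (no _)  = refl

indicator-×-dec : ∀ {A B : Set} (a : Dec A) (b : Dec B) →
                  indicator (a ×-dec b) ≡ indicator a * indicator b
indicator-×-dec (yes _) (yes _) = refl
indicator-×-dec (yes _) (no _)  = refl
indicator-×-dec (no _)  _       = refl

indicator-idem : ∀ {A : Set} (a : Dec A) → indicator a * indicator a ≡ indicator a
indicator-idem (yes _) = refl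
indicator-idem (no _)  = refl

sumFin≡sum : ∀ n (f : Fin n → ℕ) → sumFin n f ≡ sum f
sumFin≡sum zero    f = refl
sumFin≡sum (suc n) f = cong (f zero +_) (sumFin≡sum n (λ i → f (suc i)))

∑*∑≡∑∑ : ∀ {n} (f g : Fin n → ℕ) →
         sum f * sum g ≡ ∑[ x < n ] ∑[ y < n ] (f x * g y)
∑*∑≡∑∑ f g = trans (*-distribʳ-sum (sum g) f)
                   (sum-cong-≗ λ x → *-distribˡ-sum (f x) g)

∑-δ : ∀ {n} (x : Fin n) (f : Fin n → ℕ) →
      ∑[ y < n ] (indicator (y ≟ x) * f y) ≡ f x
∑-δ {suc n} zero f = begin
  f zero + 0 + ∑[ y < n ] 0  ≡⟨ cong (f zero + 0 +_) (sum-replicate-zero n) ⟩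
  f zero + 0 + 0             ≡⟨ trans (+-identityʳ _) (+-identityʳ _) ⟩
  f zero                     ∎
∑-δ {suc n} (suc x) f = begin
  0 + ∑[ y < n ] (indicator (suc y ≟ suc x) * f (suc y))
    ≡⟨ sum-cong-≗ (λ y → cong (_* f (suc y)) (indicator-⇔ suc≡suc⇔≡ (suc y ≟ suc x) (y ≟ x))) ⟩
  ∑[ y < n ] (indicator (y ≟ x) * f (suc y))
    ≡⟨ ∑-δ x (λ y → f (suc y)) ⟩
  f (suc x) ∎
  where
  suc≡suc⇔≡ : ∀ {y} → (suc y ≡ suc x) ⇔ (y ≡ x)
  suc≡suc⇔≡ = mk⇔ suc-injective (cong suc)

χ : ∀ {v} → Subset v → Fin v → ℕ
χ p x = indicator (x ∈? p)

χ-∷ : ∀ {v} s (p : Subset v) x → χ p x ≡ χ (s ∷ p) (suc x)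
χ-∷ s p x = indicator-⇔ (mk⇔ there drop-there) (x ∈? p) (suc x ∈? s ∷ p)

χ-∩ : ∀ {v} (p q : Subset v) x → χ (p ∩ q) x ≡ χ p x * χ q x
χ-∩ p q x = trans (indicator-⇔ ∩⇔× (x ∈? p ∩ q) (x ∈? p ×-dec x ∈? q))
                  (indicator-×-dec (x ∈? p) (x ∈? q))

∣p∣≡∑χ : ∀ {v} (p : Subset v) → ∣ p ∣ ≡ ∑[ x < v ] χ p x
∣p∣≡∑χ []            = refl
∣p∣≡∑χ (inside ∷ p)  = cong suc (trans (∣p∣≡∑χ p) (sum-cong-≗ (χ-∷ inside p)))
∣p∣≡∑χ (outside ∷ p) = trans (∣p∣≡∑χ p) (sum-cong-≗ (χ-∷ outside p))

∣p∩q∣≡∑χχ : ∀ {v} (p q : Subset v) → ∣ p ∩ q ∣ ≡ ∑[ x < v ] (χ p x * χ q x)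
∣p∩q∣≡∑χχ {v} p q = trans (∣p∣≡∑χ (p ∩ q)) (sum-cong-≗ {v} (χ-∩ p q))

∑-square-expand : ∀ {b v} (a : Fin v → ℕ) (c : Fin b → Fin v → ℕ) →
  ∑[ j < b ] (∑[ x < v ] (a x * c j x) * ∑[ x < v ] (a x * c j x))
    ≡ ∑[ x < v ] ∑[ y < v ] (a x * a y * ∑[ j < b ] (c j x * c j y))
∑-square-expand {b} {v} a c = begin
  ∑[ j < b ] (∑[ x < v ] (a x * c j x) * ∑[ x < v ] (a x * c j x))
    ≡⟨ sum-cong-≗ (λ j → ∑*∑≡∑∑ (λ x → a x * c j x) (λ y → a y * c j y)) ⟩
  ∑[ j < b ] ∑[ x < v ] ∑[ y < v ] (a x * c j x * (a y * c j y))
    ≡⟨ ∑-comm {b} {v} _ ⟩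
  ∑[ x < v ] ∑[ j < b ] ∑[ y < v ] (a x * c j x * (a y * c j y))
    ≡⟨ sum-cong-≗ {v} (λ x → ∑-comm {b} {v} _) ⟩
  ∑[ x < v ] ∑[ y < v ] ∑[ j < b ] (a x * c j x * (a y * c j y))
    ≡⟨ sum-cong-≗ {v} (λ x → sum-cong-≗ {v} (pull-out x)) ⟩
  ∑[ x < v ] ∑[ y < v ] (a x * a y * ∑[ j < b ] (c j x * c j y)) ∎
  where
  interchange : ∀ p q s t → p * q * (s * t) ≡ p * s * (q * t)
  interchange = solve-∀

  pull-out : ∀ x y → ∑[ j < b ] (a x * c j x * (a y * c j y))
                   ≡ a x * a y * ∑[ j < b ] (c j x * c j y)
  pull-out x y = trans (sum-cong-≗ {b} λ j → interchange (a x) (c j x) (a y) (c j y))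
                       (sym (*-distribˡ-sum {b} (a x * a y) _))

module _ {v r lam : ℕ} (P : Fin v → Fin v → ℕ)
         (P-diag : ∀ x → P x x ≡ r) (P-offdiag : ∀ x y → x ≢ y → P x y ≡ lam) where

  -- lam * w x is added on the left so that no truncated subtraction r ∸ lam occurs.
  balanced-row : ∀ (w : Fin v → ℕ) x →
    ∑[ y < v ] (w y * P x y) + lam * w x ≡ r * w x + lam * sum w
  balanced-row w x = begin
    ∑[ y < v ] (w y * P x y) + lam * w x
      ≡⟨ cong (_ +_) (∑-δ x (λ y → lam * w y)) ⟨
    ∑[ y < v ] (w y * P x y) + ∑[ y < v ] (indicator (y ≟ x) * (lam * w y))
      ≡⟨ ∑-distrib-+ {v} _ _ ⟨
    ∑[ y < v ] (w y * P x y + indicator (y ≟ x) * (lam * w y))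
      ≡⟨ sum-cong-≗ {v} pointwise ⟩
    ∑[ y < v ] (lam * w y + indicator (y ≟ x) * (r * w y))
      ≡⟨ ∑-distrib-+ {v} _ _ ⟩
    ∑[ y < v ] (lam * w y) + ∑[ y < v ] (indicator (y ≟ x) * (r * w y))
      ≡⟨ cong₂ _+_ (sym (*-distribˡ-sum lam w)) (∑-δ x (λ y → r * w y)) ⟩
    lam * sum w + r * w x
      ≡⟨ +-comm (lam * sum w) _ ⟩
    r * w x + lam * sum w ∎
    where
    on-diagonal : ∀ a b c → a * b + (c * a + 0) ≡ c * a + (b * a + 0)
    on-diagonal = solve-∀

    off-diagonal : ∀ a c → a * c + 0 ≡ c * a + 0
    off-diagonal = solve-∀

    pointwise : ∀ y → w y * P x y + indicator (y ≟ x) * (lam * w y)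
                    ≡ lam * w y + indicator (y ≟ x) * (r * w y)
    pointwise y with y ≟ x
    ... | yes refl rewrite P-diag y = on-diagonal (w y) r lam
    ... | no y≢x rewrite P-offdiag x y (y≢x ∘ sym) = off-diagonal (w y) lam

  balanced-form : ∀ (w : Fin v → ℕ) →
    ∑[ x < v ] ∑[ y < v ] (w x * w y * P x y) + lam * ∑[ x < v ] (w x * w x)
      ≡ r * ∑[ x < v ] (w x * w x) + lam * sum w * sum w
  balanced-form w = begin
    ∑[ x < v ] ∑[ y < v ] (w x * w y * P x y) + lam * ∑[ x < v ] (w x * w x)
      ≡⟨ cong₂ _+_ (sum-cong-≗ {v} row) (*-distribˡ-sum {v} lam _) ⟩
    ∑[ x < v ] (w x * ∑[ y < v ] (w y * P x y)) + ∑[ x < v ] (lam * (w x * w x))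
      ≡⟨ ∑-distrib-+ {v} _ _ ⟨
    ∑[ x < v ] (w x * ∑[ y < v ] (w y * P x y) + lam * (w x * w x))
      ≡⟨ sum-cong-≗ {v} (λ x → trans (factor-out (w x) _ lam) (cong (w x *_) (balanced-row w x))) ⟩
    ∑[ x < v ] (w x * (r * w x + lam * sum w))
      ≡⟨ sum-cong-≗ {v} (λ x → expand (w x) r (lam * sum w)) ⟩
    ∑[ x < v ] (r * (w x * w x) + lam * sum w * w x)
      ≡⟨ ∑-distrib-+ {v} _ _ ⟩
    ∑[ x < v ] (r * (w x * w x)) + ∑[ x < v ] (lam * sum w * w x)
      ≡⟨ cong₂ _+_ (*-distribˡ-sum {v} r _) (*-distribˡ-sum (lam * sum w) w) ⟨
    r * ∑[ x < v ] (w x * w x) + lam * sum w * sum w ∎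
    where
    row : ∀ x → ∑[ y < v ] (w x * w y * P x y) ≡ w x * ∑[ y < v ] (w y * P x y)
    row x = trans (sum-cong-≗ {v} λ y → *-assoc (w x) (w y) (P x y))
                  (sym (*-distribˡ-sum {v} (w x) _))

    factor-out : ∀ a s l → a * s + l * (a * a) ≡ a * (s + l * a)
    factor-out = solve-∀

    expand : ∀ a s t → a * (s * a + t) ≡ s * (a * a) + t * a
    expand = solve-∀

pairRepl-diagonal : ∀ {v b} (B : Fin b → Subset v) x → pairRepl B x x ≡ repl B x
pairRepl-diagonal {b = b} B x = begin
  sumFin b (λ j → χ (B j) x * χ (B j) x)  ≡⟨ sumFin≡sum b _ ⟩
  ∑[ j < b ] (χ (B j) x * χ (B j) x)      ≡⟨ sum-cong-≗ {b} (λ j → indicator-idem (x ∈? B j)) ⟩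
  ∑[ j < b ] χ (B j) x                    ≡⟨ sumFin≡sum b _ ⟨
  sumFin b (λ j → χ (B j) x)              ∎

∑ⱼ∣A∩Bⱼ∣²≡∑∑pairRepl : ∀ {v b} (A : Subset v) (B : Fin b → Subset v) →
  sumFin b (λ j → ∣ A ∩ B j ∣ * ∣ A ∩ B j ∣)
    ≡ ∑[ x < v ] ∑[ y < v ] (χ A x * χ A y * pairRepl B x y)
∑ⱼ∣A∩Bⱼ∣²≡∑∑pairRepl {v} {b} A B = begin
  sumFin b (λ j → ∣ A ∩ B j ∣ * ∣ A ∩ B j ∣)
    ≡⟨ sumFin≡sum b _ ⟩
  ∑[ j < b ] (∣ A ∩ B j ∣ * ∣ A ∩ B j ∣)
    ≡⟨ sum-cong-≗ {b} (λ j → cong (λ s → s * s) (∣p∩q∣≡∑χχ A (B j))) ⟩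
  ∑[ j < b ] (∑[ x < v ] (χ A x * χ (B j) x) * ∑[ x < v ] (χ A x * χ (B j) x))
    ≡⟨ ∑-square-expand (χ A) (λ j → χ (B j)) ⟩
  ∑[ x < v ] ∑[ y < v ] (χ A x * χ A y * ∑[ j < b ] (χ (B j) x * χ (B j) y))
    ≡⟨ sum-cong-≗ {v} (λ x → sum-cong-≗ {v} λ y → cong (χ A x * χ A y *_) (sumFin≡sum b _)) ⟨
  ∑[ x < v ] ∑[ y < v ] (χ A x * χ A y * pairRepl B x y) ∎

k[lk∸l+r]+lk≡rk+lkk : ∀ k l r → k * (l * k ∸ l + r) + l * k ≡ r * k + l * k * k
k[lk∸l+r]+lk≡rk+lkk zero l r = at-zero l r
  where
  at-zero : ∀ l r → l * 0 ≡ r * 0 + l * 0 * 0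
  at-zero = solve-∀
k[lk∸l+r]+lk≡rk+lkk (suc k) l r rewrite *-suc l k | m+n∸m≡n l (l * k) = at-suc k l r
  where
  at-suc : ∀ k l r → suc k * (l * k + r) + (l + l * k) ≡ r * suc k + (l + l * k) * suc k
  at-suc = solve-∀

theorem1 : (v b₁ r₁ k₁ λ₁ b₂ r₂ k₂ λ₂ : ℕ)
    (B₁ : Fin b₁ → Subset v) (B₂ : Fin b₂ → Subset v)
    → IsBlockDesign v b₁ r₁ k₁ λ₁ B₁
    → IsBlockDesign v b₂ r₂ k₂ λ₂ B₂
    → (n : Fin b₁)
    → MMᵀ (mutualIncidence B₁ B₂) n n ≡ k₁ * (λ₂ * k₁ ∸ λ₂ + r₂)
theorem1 v b₁ r₁ k₁ λ₁ b₂ r₂ k₂ λ₂ B₁ B₂ D₁ D₂ n = +-cancelʳ-≡ (λ₂ * k₁) _ _ (begin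
  MMᵀ (mutualIncidence B₁ B₂) n n + λ₂ * k₁
    ≡⟨ cong₂ _+_ (∑ⱼ∣A∩Bⱼ∣²≡∑∑pairRepl A B₂) (cong (λ₂ *_) (sym ∑χ²≡k₁)) ⟩
  ∑[ x < v ] ∑[ y < v ] (χ A x * χ A y * pairRepl B₂ x y) + λ₂ * ∑[ x < v ] (χ A x * χ A x)
    ≡⟨ balanced-form (pairRepl B₂) pairRepl-diag (IsBlockDesign.balance D₂) (χ A) ⟩
  r₂ * ∑[ x < v ] (χ A x * χ A x) + λ₂ * sum (χ A) * sum (χ A)
    ≡⟨ cong₂ (λ s t → r₂ * s + λ₂ * t * t) ∑χ²≡k₁ ∑χ≡k₁ ⟩
  r₂ * k₁ + λ₂ * k₁ * k₁
    ≡⟨ k[lk∸l+r]+lk≡rk+lkk k₁ λ₂ r₂ ⟨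
  k₁ * (λ₂ * k₁ ∸ λ₂ + r₂) + λ₂ * k₁ ∎)
  where
  A : Subset v
  A = B₁ n

  pairRepl-diag : ∀ x → pairRepl B₂ x x ≡ r₂
  pairRepl-diag x = trans (pairRepl-diagonal B₂ x) (IsBlockDesign.replication D₂ x)

  ∑χ≡k₁ : sum (χ A) ≡ k₁
  ∑χ≡k₁ = trans (sym (∣p∣≡∑χ A)) (IsBlockDesign.blockSize D₁ n)

  ∑χ²≡k₁ : ∑[ x < v ] (χ A x * χ A x) ≡ k₁
  ∑χ²≡k₁ = trans (sum-cong-≗ {v} (λ x → indicator-idem (x ∈? A))) ∑χ≡k₁
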